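{- Let the MinDecodon algorithm be the following procedure. Let $L_1$ be the list of distinct AA-sets $\mathrm{AA}(d)$ over all stop-free decodons $d$, and record each of them as encountered with rank $1$. Then for $\mathit{rank}=1,2,\dots,19$ in turn: for every $S_1\in L_1$ and every $S_2\in L_{\mathit{rank}}$, form $U=S_1\cup S_2$; if $U$ has not yet been encountered, record $U$ as encountered with rank $\mathit{rank}+1$ and append $U$ to $L_{\mathit{rank}+1}$. Then for every integer $n$ with $1\le n\le 20$, the list $L_n$ produced by MinDecodon consists of exactly those nonempty AA-sets $A$ for which the minimum number of decodons that exactly code for $A$ equals $n$.
   Context: Amino acids are the 20 standard ones $\{A,C,D,E,F,G,H,I,K,L,M,N,P,Q,R,S,T,V,W,Y\}$. An AA-set is a subset of these 20 amino acids. Codons are triples over $\{A,C,G,T\}$, translated by the standard genetic code, in which TAA, TAG and TGA are STOP codons. A degenerate codon (decodon) is a triple $d=(X_1,X_2,X_3)$ where each $X_i$ is a nonempty subset of $\{A,C,G,T\}$, so there are $15^3=3375$ decodons. A decodon $d$ represents the set of codons $X_1\times X_2\times X_3$. It is stop-free if none of these codons is a STOP codon, and $\mathrm{AA}(d)$ denotes the set of amino acids encoded by its codons. A finite set $D$ of decodons exactly codes for an AA-set $A$ if every decodon in $D$ is stop-free and $\bigcup_{d\in D}\mathrm{AA}(d)=A$. In words, $D$ codes for no extraneous amino acid and no STOP codon. -}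

module Defs where

open import Data.Nat using (ℕ; zero; suc)
open import Data.Bool using (Bool; true; false; if_then_else_)
import Data.Bool as Bool
open import Data.Fin using (Fin; zero; suc; #_)
open import Data.Fin.Subset using (Subset; _∈_; _∪_; ⋃; ⁅_⁆; ⊥; Nonempty)
open import Data.Fin.Subset.Properties using (_∈?_; nonempty?)
open import Data.List using (List; []; _∷_; _++_; [_]; map; filter; concatMap; foldl; allFin; deduplicate)
open import Data.List.Relation.Unary.All using (All)
import Data.List.Relation.Unary.All as All
open import Data.List.Relation.Unary.Any using (any?)
open import Data.Maybe using (Maybe; just; nothing; Is-just)
import Data.Maybe.Relation.Unary.Any as MAny
open import Data.Product using (_×_; _,_; proj₁; proj₂; Σ)
open import Data.Vec.Properties using (≡-dec)
import Data.Vec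
import Data.Nat
import Data.List
open import Relation.Binary.PropositionalEquality using (_≡_)
open import Relation.Binary.Definitions using (DecidableEquality)
open import Relation.Nullary using (Dec; yes; no; ¬_)
open import Relation.Nullary.Decidable using (_×-dec_)

data Base : Set where
  A C G T : Base

-- index convention for subsets of {A,C,G,T}: A=0, C=1, G=2, T=3
base : Fin 4 → Base
base zero = A
base (suc zero) = C
base (suc (suc zero)) = G
base (suc (suc (suc zero))) = T

data AminoAcid : Set where
  Ala Cys Asp Glu Phe Gly His Ile Lys Leu Met Asn Pro Gln Arg Ser Thr Val Trp Tyr : AminoAcid

aaIndex : AminoAcid → Fin 20
aaIndex Ala = # 0
aaIndex Cys = # 1
aaIndex Asp = # 2
aaIndex Glu = # 3
aaIndex Phe = # 4
aaIndex Gly = # 5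
aaIndex His = # 6
aaIndex Ile = # 7
aaIndex Lys = # 8
aaIndex Leu = # 9
aaIndex Met = # 10
aaIndex Asn = # 11
aaIndex Pro = # 12
aaIndex Gln = # 13
aaIndex Arg = # 14
aaIndex Ser = # 15
aaIndex Thr = # 16
aaIndex Val = # 17
aaIndex Trp = # 18
aaIndex Tyr = # 19

AASet : Set
AASet = Subset 20

-- standard genetic code; nothing = STOP
translate : Base → Base → Base → Maybe AminoAcid
translate T T T = just Phe
translate T T C = just Phe
translate T T A = just Leu
translate T T G = just Leu
translate C T _ = just Leu
translate A T T = just Ile
translate A T C = just Ile
translate A T A = just Ile
translate A T G = just Met
translate G T _ = just Val
translate T C _ = just Ser
translate C C _ = just Pro
translate A C _ = just Thr
translate G C _ = just Ala
translate T A T = just Tyr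
translate T A C = just Tyr
translate T A A = nothing
translate T A G = nothing
translate C A T = just His
translate C A C = just His
translate C A A = just Gln
translate C A G = just Gln
translate A A T = just Asn
translate A A C = just Asn
translate A A A = just Lys
translate A A G = just Lys
translate G A T = just Asp
translate G A C = just Asp
translate G A A = just Glu
translate G A G = just Glu
translate T G T = just Cys
translate T G C = just Cys
translate T G A = nothing
translate T G G = just Trp
translate C G _ = just Arg
translate A G T = just Ser
translate A G C = just Ser
translate A G A = just Arg
translate A G G = just Arg
translate G G _ = just Gly

Codon : Set
Codon = Base × Base × Base

Decodon : Set
Decodon = Subset 4 × Subset 4 × Subset 4

ValidDecodon : Decodon → Set
ValidDecodon (X₁ , X₂ , X₃) = Nonempty X₁ × Nonempty X₂ × Nonempty X₃

validDecodon? : (d : Decodon) → Dec (ValidDecodon d)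
validDecodon? (X₁ , X₂ , X₃) = nonempty? X₁ ×-dec (nonempty? X₂ ×-dec nonempty? X₃)

elems : Subset 4 → List (Fin 4)
elems X = filter (_∈? X) (allFin 4)

codons : Decodon → List Codon
codons (X₁ , X₂ , X₃) =
  concatMap (λ x → concatMap (λ y → map (λ z → base x , base y , base z) (elems X₃)) (elems X₂)) (elems X₁)

tr : Codon → Maybe AminoAcid
tr (x , y , z) = translate x y z

StopFree : Decodon → Set
StopFree d = All (λ c → Is-just (tr c)) (codons d)

stopFree? : (d : Decodon) → Dec (StopFree d)
stopFree? d = All.all? (λ c → MAny.dec (λ _ → yes Data.Unit.tt) (tr c)) (codons d)
  where import Data.Unit

aaOf : Maybe AminoAcid → AASet
aaOf nothing = ⊥
aaOf (just a) = ⁅ aaIndex a ⁆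

AA : Decodon → AASet
AA d = ⋃ (map (λ c → aaOf (tr c)) (codons d))

ExactlyCodes : List Decodon → AASet → Set
ExactlyCodes D S = All (λ d → ValidDecodon d × StopFree d) D × (⋃ (map AA D) ≡ S)

MinDecodons : AASet → ℕ → Set
MinDecodons S n =
  Σ (List Decodon) (λ D → Data.List.length D ≡ n × ExactlyCodes D S)
  × (∀ (D : List Decodon) → ExactlyCodes D S → n Data.Nat.≤ Data.List.length D)

_≟ˢ_ : DecidableEquality AASet
_≟ˢ_ = ≡-dec Bool._≟_

allSubsets : (n : ℕ) → List (Subset n)
allSubsets zero = Data.Vec.[] ∷ []
allSubsets (suc n) = concatMap (λ b → map (b Data.Vec.∷_) (allSubsets n)) (true ∷ false ∷ [])

allDecodons : List Decodon
allDecodons = filter validDecodon?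
  (concatMap (λ X₁ → concatMap (λ X₂ → map (λ X₃ → X₁ , X₂ , X₃) (allSubsets 4)) (allSubsets 4)) (allSubsets 4))

L₁ : List AASet
L₁ = deduplicate _≟ˢ_ (map AA (filter stopFree? allDecodons))

step : List AASet → List AASet → List AASet × List AASet
step E Lr = foldl visit (E , []) (concatMap (λ S₁ → map (λ S₂ → S₁ ∪ S₂) Lr) L₁)
  where
  visit : List AASet × List AASet → AASet → List AASet × List AASet
  visit (E′ , new) U with any? (U ≟ˢ_) E′
  ... | yes _ = E′ , new
  ... | no  _ = U ∷ E′ , new ++ [ U ]

-- run k = (encountered sets after producing L_(k+1), L_(k+1))
run : ℕ → List AASet × List AASet
run zero = L₁ , L₁
run (suc k) = step (proj₁ (run k)) (proj₂ (run k))

-- L n = the list L_n produced by MinDecodon (L 0 unused)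
L : ℕ → List AASet
L zero = []
L (suc k) = proj₂ (run k)

-- A set coded exactly by r + 1 decodons is AA(d) ∪ T for a stop-free decodon d and a set T
-- coded by r decodons, and if r + 1 is the minimum for AA(d) ∪ T then r is the minimum for T.
-- So, by induction on the rank r, once L_r is built the encountered sets are exactly those coded
-- by between 1 and r decodons and L_r lists those of minimum r: a union AA(d) ∪ T with T ∈ L_r
-- that has not been encountered yet is precisely a set of minimum r + 1.

module Submission where

open import Defs
open import Data.Nat using (ℕ; _≤_)
open import Data.Fin.Subset using (Nonempty)
open import Data.List.Membership.Propositional using (_∈_)
open import Data.Product using (_×_)
open import Function.Bundles using (_⇔_)

open import Data.Nat using (zero; suc; _<_; s≤s; z≤n)
open import Data.Nat.Properties using (≤-antisym; ≤-pred; ≮⇒≥; <⇒≱; m<n⇒m<1+n; n<1+n; suc-injective)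
open import Data.Bool using (true; false)
open import Data.Fin using (Fin)
open import Data.Fin.Subset using (Subset; _∪_; ⋃) renaming (_∈_ to _∈ₛ_)
open import Data.Fin.Subset.Properties using (x∈⁅x⁆; ∉⊥; ∪-identityʳ; p⊆p∪q; q⊆p∪q)
  renaming (_∈?_ to _∈ₛ?_)
open import Data.List using (List; []; _∷_; _++_; [_]; map; filter; concatMap; foldl; length; deduplicate)
open import Data.List.Relation.Unary.All using ([]; _∷_)
import Data.List.Relation.Unary.All as All
open import Data.List.Relation.Unary.Any using (here; there; any?)
open import Data.List.Membership.Propositional using (_∉_; find; lose)
open import Data.List.Membership.Propositional.Properties
  using (∈-map⁺; ∈-map⁻; ∈-++⁺ˡ; ∈-++⁺ʳ; ∈-++⁻; ∈-filter⁺; ∈-filter⁻;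
         ∈-deduplicate⁺; ∈-deduplicate⁻; ∈-allFin; ∈-concatMap⁺; ∈-concatMap⁻)
open import Data.List.Membership.DecPropositional _≟ˢ_ using (_∈?_)
open import Data.Maybe using (Maybe; just; Is-just)
open import Data.Product using (_,_; proj₁; proj₂; Σ-syntax; ∃-syntax; ∃₂)
open import Data.Sum using (_⊎_; inj₁; inj₂)
import Data.Sum as Sum
import Data.Product as Product
import Data.Vec as Vec
open import Function using (id; _∘_)
open import Function.Bundles using (mk⇔; Equivalence)
open import Function.Properties.Equivalence using () renaming (trans to ⇔-trans; sym to ⇔-sym)
open import Relation.Binary.Definitions using (DecidableEquality)
open import Relation.Binary.PropositionalEquality using (_≡_; refl; sym; subst)
open import Relation.Nullary using (¬_; yes; no; contradiction)

open Equivalence using (to; from)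

module Recording {Item : Set} (_≟_ : DecidableEquality Item)
  (visit : List Item × List Item → Item → List Item × List Item)
  (visit-seen : ∀ {E new u} → u ∈ E → visit (E , new) u ≡ (E , new))
  (visit-unseen : ∀ {E new u} → u ∉ E → visit (E , new) u ≡ (u ∷ E , new ++ [ u ]))
  where

  seen-foldl : ∀ xs E new {x} → x ∈ proj₁ (foldl visit (E , new) xs) ⇔ (x ∈ E ⊎ x ∈ xs)
  seen-foldl []       E new = mk⇔ inj₁ Sum.[ id , (λ ()) ]
  seen-foldl (u ∷ xs) E new with any? (u ≟_) E
  ... | yes u∈E rewrite visit-seen {new = new} u∈E =
    ⇔-trans (seen-foldl xs E new) (mk⇔ (Sum.map₂ there) Sum.[ inj₁ , absorb ])
    where
    absorb : ∀ {x} → x ∈ u ∷ xs → x ∈ E ⊎ x ∈ xs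
    absorb (here refl) = inj₁ u∈E
    absorb (there x∈xs) = inj₂ x∈xs
  ... | no u∉E rewrite visit-unseen {new = new} u∉E =
    ⇔-trans (seen-foldl xs (u ∷ E) (new ++ [ u ])) (mk⇔ shiftʳ Sum.[ inj₁ ∘ there , shiftˡ ])
    where
    shiftʳ : ∀ {x} → x ∈ u ∷ E ⊎ x ∈ xs → x ∈ E ⊎ x ∈ u ∷ xs
    shiftʳ (inj₁ (here refl)) = inj₂ (here refl)
    shiftʳ (inj₁ (there x∈E)) = inj₁ x∈E
    shiftʳ (inj₂ x∈xs) = inj₂ (there x∈xs)
    shiftˡ : ∀ {x} → x ∈ u ∷ xs → x ∈ u ∷ E ⊎ x ∈ xs
    shiftˡ (here refl) = inj₁ (here refl)
    shiftˡ (there x∈xs) = inj₂ x∈xs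

  recorded-foldl : ∀ xs E new {x} →
    x ∈ proj₂ (foldl visit (E , new) xs) ⇔ (x ∈ new ⊎ (x ∈ xs × x ∉ E))
  recorded-foldl []       E new = mk⇔ inj₁ Sum.[ id , (λ ()) ∘ proj₁ ]
  recorded-foldl (u ∷ xs) E new with any? (u ≟_) E
  ... | yes u∈E rewrite visit-seen {new = new} u∈E =
    ⇔-trans (recorded-foldl xs E new) (mk⇔ (Sum.map₂ (Product.map₁ there)) Sum.[ inj₁ , skip ])
    where
    skip : ∀ {x} → x ∈ u ∷ xs × x ∉ E → x ∈ new ⊎ (x ∈ xs × x ∉ E)
    skip (here refl , u∉E) = contradiction u∈E u∉E
    skip (there x∈xs , x∉E) = inj₂ (x∈xs , x∉E)
  ... | no u∉E rewrite visit-unseen {new = new} u∉E =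
    ⇔-trans (recorded-foldl xs (u ∷ E) (new ++ [ u ])) (mk⇔ shiftʳ shiftˡ)
    where
    shiftʳ : ∀ {x} → x ∈ new ++ [ u ] ⊎ (x ∈ xs × x ∉ u ∷ E) → x ∈ new ⊎ (x ∈ u ∷ xs × x ∉ E)
    shiftʳ (inj₁ x∈new++u) with ∈-++⁻ new x∈new++u
    ... | inj₁ x∈new = inj₁ x∈new
    ... | inj₂ (here refl) = inj₂ (here refl , u∉E)
    shiftʳ (inj₂ (x∈xs , x∉u∷E)) = inj₂ (there x∈xs , x∉u∷E ∘ there)
    shiftˡ : ∀ {x} → x ∈ new ⊎ (x ∈ u ∷ xs × x ∉ E) → x ∈ new ++ [ u ] ⊎ (x ∈ xs × x ∉ u ∷ E)
    shiftˡ (inj₁ x∈new) = inj₁ (∈-++⁺ˡ x∈new)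
    shiftˡ (inj₂ (here refl , _)) = inj₁ (∈-++⁺ʳ new (here refl))
    shiftˡ {x} (inj₂ (there x∈xs , x∉E)) with x ≟ u
    ... | yes refl = inj₁ (∈-++⁺ʳ new (here refl))
    ... | no x≢u = inj₂ (x∈xs , λ { (here x≡u) → x≢u x≡u ; (there x∈E) → x∉E x∈E })

∈-allSubsets : ∀ n (X : Subset n) → X ∈ allSubsets n
∈-allSubsets zero    Vec.[]       = here refl
∈-allSubsets (suc n) (b Vec.∷ X) = ∈-concatMap⁺ (λ c → map (c Vec.∷_) (allSubsets n))
  (lose (bool∈ b) (∈-map⁺ (b Vec.∷_) (∈-allSubsets n X)))
  where
  bool∈ : ∀ b → b ∈ true ∷ false ∷ []
  bool∈ true  = here refl
  bool∈ false = there (here refl)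

decodonTriples : List Decodon
decodonTriples =
  concatMap (λ X₁ → concatMap (λ X₂ → map (λ X₃ → X₁ , X₂ , X₃) (allSubsets 4)) (allSubsets 4)) (allSubsets 4)

∈-allDecodons⇔ : ∀ {d} → d ∈ allDecodons ⇔ ValidDecodon d
∈-allDecodons⇔ {X₁ , X₂ , X₃} =
  mk⇔ (proj₂ ∘ ∈-filter⁻ validDecodon? {xs = decodonTriples}) (∈-filter⁺ validDecodon? triple∈)
  where
  triplesFrom : Subset 4 → Subset 4 → List Decodon
  triplesFrom Y₁ Y₂ = map (λ Y₃ → Y₁ , Y₂ , Y₃) (allSubsets 4)
  triple∈ : (X₁ , X₂ , X₃) ∈ decodonTriples
  triple∈ = ∈-concatMap⁺ (λ Y₁ → concatMap (triplesFrom Y₁) (allSubsets 4)) (lose (∈-allSubsets 4 X₁)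
    (∈-concatMap⁺ (triplesFrom X₁) (lose (∈-allSubsets 4 X₂) (∈-map⁺ (λ Y₃ → X₁ , X₂ , Y₃) (∈-allSubsets 4 X₃)))))

∈-elems : ∀ {X : Subset 4} {x} → x ∈ₛ X → x ∈ elems X
∈-elems {X} {x} x∈X = ∈-filter⁺ (_∈ₛ? X) (∈-allFin x) x∈X

∈-codons : ∀ {X₁ X₂ X₃ x y z} → x ∈ₛ X₁ → y ∈ₛ X₂ → z ∈ₛ X₃ →
  (base x , base y , base z) ∈ codons (X₁ , X₂ , X₃)
∈-codons {X₁} {X₂} {X₃} {x} {y} {z} x∈X₁ y∈X₂ z∈X₃ =
  ∈-concatMap⁺ (λ x′ → concatMap (codonsFrom x′) (elems X₂)) (lose (∈-elems x∈X₁)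
    (∈-concatMap⁺ (codonsFrom x) (lose (∈-elems y∈X₂) (∈-map⁺ (λ z′ → base x , base y , base z′) (∈-elems z∈X₃)))))
  where
  codonsFrom : Fin 4 → Fin 4 → List Codon
  codonsFrom x′ y′ = map (λ z′ → base x′ , base y′ , base z′) (elems X₃)

∈-⋃⁺ : ∀ {n} {x : Fin n} {X Xs} → x ∈ₛ X → X ∈ Xs → x ∈ₛ ⋃ Xs
∈-⋃⁺ {Xs = X ∷ Xs} x∈X (here refl)  = p⊆p∪q (⋃ Xs) x∈X
∈-⋃⁺ {Xs = Y ∷ Xs} x∈X (there X∈Xs) = q⊆p∪q Y (⋃ Xs) (∈-⋃⁺ x∈X X∈Xs)

aaOf-nonempty : ∀ {m : Maybe AminoAcid} → Is-just m → Nonempty (aaOf m)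
aaOf-nonempty {just a} _ = aaIndex a , x∈⁅x⁆ (aaIndex a)

StopFreeDecodon : Decodon → Set
StopFreeDecodon d = ValidDecodon d × StopFree d

AA-nonempty : ∀ {d} → StopFreeDecodon d → Nonempty (AA d)
AA-nonempty (((x , x∈X₁) , (y , y∈X₂) , (z , z∈X₃)) , stopFree) =
  let c∈ = ∈-codons x∈X₁ y∈X₂ z∈X₃
      a , a∈ = aaOf-nonempty (All.lookup stopFree c∈)
  in a , ∈-⋃⁺ a∈ (∈-map⁺ (aaOf ∘ tr) c∈)

stopFreeAASets : List Decodon → List AASet
stopFreeAASets Ds = deduplicate _≟ˢ_ (map AA (filter stopFree? Ds))

∈-stopFreeAASets⇔ : ∀ {Ds S} → S ∈ stopFreeAASets Ds ⇔ (∃[ d ] d ∈ Ds × StopFree d × AA d ≡ S)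
∈-stopFreeAASets⇔ {Ds} {S} = mk⇔ decodonOf
  (λ (d , d∈Ds , stopFree , AAd≡S) →
    subst (_∈ _) AAd≡S (∈-deduplicate⁺ _≟ˢ_ (∈-map⁺ AA (∈-filter⁺ stopFree? d∈Ds stopFree))))
  where
  decodonOf : S ∈ stopFreeAASets Ds → ∃[ d ] d ∈ Ds × StopFree d × AA d ≡ S
  decodonOf S∈ =
    let d , d∈ , S≡AAd = ∈-map⁻ AA (∈-deduplicate⁻ _≟ˢ_ _ S∈)
        d∈Ds , stopFree = ∈-filter⁻ stopFree? d∈
    in d , d∈Ds , stopFree , sym S≡AAd

-- Stated for a neutral predicate: relating L₁ to its unfolding under `_∈_` makes the
-- conversion checker evaluate the whole list.
L₁-unfolding : (P : List AASet → Set) → P (stopFreeAASets allDecodons) → P L₁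
L₁-unfolding P p = p

∈-L₁⇔ : ∀ {S} → S ∈ L₁ ⇔ (∃[ d ] StopFreeDecodon d × AA d ≡ S)
∈-L₁⇔ {S} = L₁-unfolding (λ X → S ∈ X ⇔ (∃[ d ] StopFreeDecodon d × AA d ≡ S)) (⇔-trans ∈-stopFreeAASets⇔ (mk⇔
  (λ (d , d∈ , stopFree , AAd≡S) → d , (to ∈-allDecodons⇔ d∈ , stopFree) , AAd≡S)
  (λ (d , (valid , stopFree) , AAd≡S) → d , from ∈-allDecodons⇔ valid , stopFree , AAd≡S)))

Codable : ℕ → AASet → Set
Codable m S = Σ[ D ∈ List Decodon ] (length D ≡ m × ExactlyCodes D S)

CodableWithin : ℕ → AASet → Set
CodableWithin r S = ∃[ m ] (m < r × Codable (suc m) S)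

Codable-∷ : ∀ {d S m T} → StopFreeDecodon d → AA d ≡ S → Codable m T → Codable (suc m) (S ∪ T)
Codable-∷ {d} stopFree refl (D , refl , stopFrees , refl) = d ∷ D , refl , stopFree ∷ stopFrees , refl

Codable-nonempty : ∀ {m S} → Codable (suc m) S → Nonempty S
Codable-nonempty (d ∷ D , _ , stopFree ∷ _ , refl) =
  let a , a∈AAd = AA-nonempty stopFree in a , p⊆p∪q (⋃ (map AA D)) a∈AAd

∈-L₁⇔Codable-1 : ∀ {S} → S ∈ L₁ ⇔ Codable 1 S
∈-L₁⇔Codable-1 = ⇔-trans ∈-L₁⇔ (mk⇔
  (λ { (d , stopFree , refl) → d ∷ [] , refl , stopFree ∷ [] , ∪-identityʳ (AA d) })
  (λ { (d ∷ [] , refl , stopFree ∷ [] , refl) → d , stopFree , sym (∪-identityʳ (AA d)) }))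

¬within⇒≤ : ∀ {r m S} → ¬ CodableWithin r S → Codable (suc m) S → r ≤ m
¬within⇒≤ ¬within codable = ≮⇒≥ (λ m<r → ¬within (_ , m<r , codable))

minDecodons⇔ : ∀ {r S} → MinDecodons S (suc r) ⇔ (Codable (suc r) S × ¬ CodableWithin r S)
minDecodons⇔ {r} {S} = mk⇔
  (λ (codable , minimal) → codable ,
     λ (m , m<r , D , len≡ , codes) → <⇒≱ m<r (≤-pred (subst (suc r ≤_) len≡ (minimal D codes))))
  (λ (codable , ¬within) → codable , minimal codable ¬within)
  where
  minimal : Codable (suc r) S → ¬ CodableWithin r S → ∀ D → ExactlyCodes D S → suc r ≤ length D
  minimal codable _ [] (_ , refl) = contradiction (proj₂ (Codable-nonempty codable)) ∉⊥
  minimal _ ¬within (d ∷ D) codes = s≤s (¬within⇒≤ ¬within (d ∷ D , refl , codes))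

minimal-split : ∀ {r U} → Codable (suc r) U → ¬ CodableWithin r U →
  ∃₂ λ d T → StopFreeDecodon d × MinDecodons T r × U ≡ AA d ∪ T
minimal-split {r} (d ∷ D , len≡ , stopFree ∷ stopFrees , refl) ¬within =
  d , ⋃ (map AA D) , stopFree , ((D , suc-injective len≡ , stopFrees , refl) , minimal) , refl
  where
  minimal : ∀ D′ → ExactlyCodes D′ (⋃ (map AA D)) → r ≤ length D′
  minimal D′ codes = ¬within⇒≤ ¬within (Codable-∷ stopFree refl (D′ , refl , codes))

pairwiseUnions : List AASet → List AASet → List AASet
pairwiseUnions L L′ = concatMap (λ S₁ → map (S₁ ∪_) L′) L

∈-pairwiseUnions⁺ : ∀ {L L′ U S₁ S₂} → S₁ ∈ L → S₂ ∈ L′ → U ≡ S₁ ∪ S₂ → U ∈ pairwiseUnions L L′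
∈-pairwiseUnions⁺ {L′ = L′} {S₁ = S₁} S₁∈L S₂∈L′ refl =
  ∈-concatMap⁺ (λ S → map (S ∪_) L′) (lose S₁∈L (∈-map⁺ (S₁ ∪_) S₂∈L′))

∈-pairwiseUnions⁻ : ∀ {L L′ U} → U ∈ pairwiseUnions L L′ →
  ∃₂ λ S₁ S₂ → S₁ ∈ L × S₂ ∈ L′ × U ≡ S₁ ∪ S₂
∈-pairwiseUnions⁻ {L′ = L′} U∈ =
  let S₁ , S₁∈L , U∈S₁∪L′ = find (∈-concatMap⁻ (λ S → map (S ∪_) L′) U∈)
      S₂ , S₂∈L′ , U≡S₁∪S₂ = ∈-map⁻ (S₁ ∪_) U∈S₁∪L′
  in S₁ , S₂ , S₁∈L , S₂∈L′ , U≡S₁∪S₂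

-- The visitor is local to `step`; unification against its definition names it.
stepVisitor : (E Lr : List AASet) →
  Σ[ visit ∈ (List AASet × List AASet → AASet → List AASet × List AASet) ]
    step E Lr ≡ foldl visit (E , []) (pairwiseUnions L₁ Lr)
stepVisitor E Lr = _ , refl

module _ (E Lr : List AASet) where

  private
    visit : List AASet × List AASet → AASet → List AASet × List AASet
    visit = proj₁ (stepVisitor E Lr)

    visit-seen : ∀ {E′ new u} → u ∈ E′ → visit (E′ , new) u ≡ (E′ , new)
    visit-seen {E′} {u = u} u∈E′ with any? (u ≟ˢ_) E′
    ... | yes _    = refl
    ... | no u∉E′ = contradiction u∈E′ u∉E′

    visit-unseen : ∀ {E′ new u} → u ∉ E′ → visit (E′ , new) u ≡ (u ∷ E′ , new ++ [ u ])
    visit-unseen {E′} {u = u} u∉E′ with any? (u ≟ˢ_) E′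
    ... | yes u∈E′ = contradiction u∈E′ u∉E′
    ... | no _     = refl

  open Recording _≟ˢ_ visit visit-seen visit-unseen

  ∈-step-encountered : ∀ {S} → S ∈ proj₁ (step E Lr) ⇔ (S ∈ E ⊎ S ∈ pairwiseUnions L₁ Lr)
  ∈-step-encountered = seen-foldl (pairwiseUnions L₁ Lr) E []

  ∈-step-list : ∀ {S} → S ∈ proj₂ (step E Lr) ⇔ (S ∈ pairwiseUnions L₁ Lr × S ∉ E)
  ∈-step-list = ⇔-trans (recorded-foldl (pairwiseUnions L₁ Lr) E []) (mk⇔ Sum.[ (λ ()) , id ] inj₂)

record Invariant (r : ℕ) (E Lr : List AASet) : Set where
  field
    encountered : ∀ {S} → S ∈ E ⇔ CodableWithin r S
    listed      : ∀ {S} → S ∈ Lr ⇔ MinDecodons S r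

L₁-invariant : Invariant 1 L₁ L₁
L₁-invariant = record
  { encountered = ⇔-trans ∈-L₁⇔Codable-1
      (mk⇔ (λ codable → 0 , s≤s z≤n , codable) λ { (zero , _ , codable) → codable ; (suc _ , s≤s () , _) })
  ; listed = ⇔-trans ∈-L₁⇔Codable-1
      (⇔-trans (mk⇔ (_, λ { (_ , () , _) }) proj₁) (⇔-sym minDecodons⇔))
  }

module _ {r E Lr} (inv : Invariant r E Lr) where
  open Invariant inv

  pairwiseUnions-codable : ∀ {U} → U ∈ pairwiseUnions L₁ Lr → Codable (suc r) U
  pairwiseUnions-codable U∈ =
    let S₁ , S₂ , S₁∈L₁ , S₂∈Lr , U≡S₁∪S₂ = ∈-pairwiseUnions⁻ {L₁} {Lr} U∈
        _ , stopFree , AAd≡S₁ = to ∈-L₁⇔ S₁∈L₁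
    in subst (Codable (suc r)) (sym U≡S₁∪S₂) (Codable-∷ stopFree AAd≡S₁ (proj₁ (to listed S₂∈Lr)))

  minimal-∈-pairwiseUnions : ∀ {U} → Codable (suc r) U → ¬ CodableWithin r U → U ∈ pairwiseUnions L₁ Lr
  minimal-∈-pairwiseUnions {U} codable ¬within =
    let d , _ , stopFree , minT , U≡AAd∪T = minimal-split codable ¬within
    in ∈-pairwiseUnions⁺ {L₁} {Lr} {U} (from ∈-L₁⇔ (d , stopFree , refl)) (from listed minT) U≡AAd∪T

  step-invariant : Invariant (suc r) (proj₁ (step E Lr)) (proj₂ (step E Lr))
  step-invariant = record
    { encountered = ⇔-trans (∈-step-encountered E Lr) (mk⇔ within within⁻¹)
    ; listed = ⇔-trans (∈-step-list E Lr) (⇔-trans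
        (mk⇔ (λ (U∈ , S∉E) → pairwiseUnions-codable U∈ , S∉E ∘ from encountered)
             (λ (codable , ¬within) → minimal-∈-pairwiseUnions codable ¬within , ¬within ∘ to encountered))
        (⇔-sym minDecodons⇔))
    }
    where
    within : ∀ {S} → S ∈ E ⊎ S ∈ pairwiseUnions L₁ Lr → CodableWithin (suc r) S
    within (inj₁ S∈E) = let m , m<r , codable = to encountered S∈E in m , m<n⇒m<1+n m<r , codable
    within (inj₂ S∈)  = r , n<1+n r , pairwiseUnions-codable S∈
    within⁻¹ : ∀ {S} → CodableWithin (suc r) S → S ∈ E ⊎ S ∈ pairwiseUnions L₁ Lr
    within⁻¹ {S} (m , m<1+r , codable) with S ∈? E
    ... | yes S∈E = inj₁ S∈E
    ... | no  S∉E = inj₂ (minimal-∈-pairwiseUnions (subst (λ k → Codable (suc k) S) m≡r codable) ¬within)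
      where
      ¬within : ¬ CodableWithin r S
      ¬within = S∉E ∘ from encountered
      m≡r : m ≡ r
      m≡r = ≤-antisym (≤-pred m<1+r) (¬within⇒≤ ¬within codable)

run-invariant : ∀ k → Invariant (suc k) (proj₁ (run k)) (proj₂ (run k))
run-invariant zero    = L₁-invariant
run-invariant (suc k) = step-invariant (run-invariant k)

theorem1 : (n : ℕ) → 1 ≤ n → n ≤ 20 → (S : AASet) →
    (S ∈ L n) ⇔ (Nonempty S × MinDecodons S n)
theorem1 (suc k) _ _ S = ⇔-trans (Invariant.listed (run-invariant k))
  (mk⇔ (λ minimal → Codable-nonempty (proj₁ minimal) , minimal) proj₂)
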